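{- Let $F$ be an hke collection with $\alpha=\alpha(F)$. Then $F$ is a maximal hke collection if and only if $|F|=2^{\alpha}$.
   Context: All collections are non-empty finite collections of finite sets. A collection $F$ is an \emph{hke (hereditary König–Egerváry) collection} if there is a positive integer $\alpha$ such that $|\bigcup \Gamma|+|\bigcap \Gamma|=2\alpha$ for every non-empty subcollection $\Gamma\subseteq F$; this $\alpha$ is denoted $\alpha(F)$ (in particular every member of $F$ has exactly $\alpha(F)$ elements). An hke collection $F$ is \emph{maximal} if there is no hke collection $F'$ with $F\subsetneq F'$ (the members of $F'$ may be arbitrary finite sets). -}

module Defs where

open import Data.Nat using (ℕ; _+_; _*_; _≤_)
open import Data.Nat.Properties using (_≟_)
open import Data.List using (List; []; _∷_; length; concat; filter; deduplicate)
open import Data.List.Relation.Unary.All using (all?)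
open import Data.List.Membership.DecPropositional _≟_ using (_∈?_)
open import Data.List.Relation.Binary.Subset.Propositional using (_⊆_)
open import Data.List.Relation.Binary.Sublist.Propositional using () renaming (_⊆_ to _⊑_)
open import Data.List.Relation.Unary.AllPairs using (AllPairs)
open import Data.List.Relation.Unary.All using (All)
open import Data.List.Relation.Unary.Any using (Any)
open import Data.Product using (_×_; ∃)
open import Relation.Binary.PropositionalEquality using (_≡_; _≢_)
open import Relation.Nullary using (¬_)

-- A finite set of elements (drawn from ℕ) is represented by a list;
-- the list is read as a set (order and repetitions are irrelevant).
FSet : Set
FSet = List ℕ

card : FSet → ℕ
card S = length (deduplicate _≟_ S)

_≋_ : FSet → FSet → Set
S ≋ T = (S ⊆ T) × (T ⊆ S)

Coll : Set
Coll = List FSet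

Distinct : Coll → Set
Distinct F = AllPairs (λ S T → ¬ (S ≋ T)) F

⋃ : Coll → FSet
⋃ Γ = concat Γ

⋂ : Coll → FSet
⋂ [] = []
⋂ (S ∷ Γ) = filter (λ x → all? (λ T → x ∈? T) Γ) S

-- Γ is a non-empty subcollection of F
-- (a sublist of F; since F has distinct members this is a subcollection)
SubColl : Coll → Coll → Set
SubColl Γ F = (Γ ⊑ F) × (Γ ≢ [])

IsHKE : Coll → ℕ → Set
IsHKE F α =
  (F ≢ []) × (1 ≤ α) ×
  (∀ Γ → SubColl Γ F → card (⋃ Γ) + card (⋂ Γ) ≡ 2 * α)

HKE : Coll → Set
HKE F = ∃ λ α → IsHKE F α

_⊆C_ : Coll → Coll → Set
F ⊆C G = All (λ S → Any (λ T → S ≋ T) G) F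

_⊂C_ : Coll → Coll → Set
F ⊂C G = (F ⊆C G) × ¬ (G ⊆C F)

Maximal : Coll → Set
Maximal F = HKE F × ¬ (∃ λ F' → Distinct F' × HKE F' × (F ⊂C F'))

-- Every hke collection F with α ≥ 1 has a splitting pair x ≠ y: each member contains exactly
-- one of them. If some x lies in all members, pair it with a fresh y. Otherwise take y₀ ∈ ⋃ F
-- lying in the fewest members; the members avoiding y₀ have a smaller union than F, hence a
-- common element w, and minimality of y₀ forbids a member containing both y₀ and w.
-- Deleting x and y from all members lowers each |⋃ Γ| + |⋂ Γ| by exactly 2, so by induction F
-- lies, up to set equality, in the cube of α disjoint pairs: the 2^α sets choosing one element
-- from each pair. The cube is itself hke, so |F| ≤ 2^α, with equality exactly when F is the
-- whole cube, i.e. when no hke collection strictly extends F.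
module Submission where

open import Defs
open import Data.Nat using (ℕ; zero; suc; _+_; _*_; _^_; _≤_; _<_; z≤n; s≤s)
open import Data.Nat.Properties
open import Data.List using (List; []; _∷_; length; filter; map; _++_)
open import Data.List.Properties using (≡-dec; length-removeAt′; filter-all; filter-accept; filter-reject; length-++; length-map; ++-identityʳ)
open import Data.List.Membership.Propositional using (_∈_; _∉_; find; lose)
open import Data.List.Membership.Propositional.Properties
open import Data.List.Relation.Unary.Any.Properties using (¬Any[])
open import Data.List.Membership.DecPropositional _≟_ using (_∈?_)
open import Data.List.Relation.Binary.Subset.Propositional using (_⊆_)
open import Data.List.Relation.Binary.Subset.DecPropositional _≟_ using (_⊆?_)
open import Data.List.Relation.Binary.Subset.Propositional.Properties using (∷⁺ʳ)
open import Data.List.Relation.Binary.Sublist.Propositional.Properties using () renaming (All-resp-⊆ to All-resp-⊑; filter-⊆ to filter-⊑)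
open import Data.List.Relation.Binary.Sublist.Propositional using ([]; _∷ʳ_; _∷_; ⊆-refl; from∈) renaming (_⊆_ to _⊑_; lookup to ⊑-lookup)
open import Data.List.Relation.Unary.All as All using (All; []; _∷_)
open import Data.List.Relation.Unary.Any as Any using (Any; here; there; _─_; index)
open import Data.List.Relation.Unary.AllPairs as AllPairs using (AllPairs; []; _∷_)
open import Data.List.Relation.Unary.Unique.Propositional using (Unique)
import Data.List.Relation.Unary.AllPairs.Properties as APP
open import Data.List.Relation.Unary.Unique.DecPropositional.Properties _≟_ using (deduplicate-!)
open import Data.List.Relation.Unary.All.Properties using (¬All⇒Any¬; ¬Any⇒All¬; All¬⇒¬Any)
import Data.List.Relation.Unary.All.Properties as AllP
open import Data.List.Extrema.Nat using (argmin; argmin-all; f[argmin]≤f[xs]; max; xs≤max)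
open import Data.Product using (_×_; _,_; proj₁; proj₂; ∃)
open import Data.Sum using (_⊎_; inj₁; inj₂)
open import Data.Empty using (⊥-elim)
open import Function using (_∘_)
open import Function.Bundles using (_⇔_; mk⇔)
open import Relation.Binary.Definitions using (Symmetric; Transitive)
open import Relation.Nullary using (¬_; Dec; yes; no; ¬?)
open import Relation.Nullary.Decidable using (_⊎-dec_; _×-dec_; decidable-stable)
open import Relation.Binary.PropositionalEquality using (_≡_; _≢_; refl; sym; trans; cong; cong₂; subst; module ≡-Reasoning)

∈⇒≢[] : ∀ {A : Set} {x : A} {xs} → x ∈ xs → xs ≢ []
∈⇒≢[] (here _)  ()
∈⇒≢[] (there _) ()

map≢[] : ∀ {A B : Set} {f : A → B} {xs} → xs ≢ [] → map f xs ≢ []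
map≢[] {xs = []}    xs≢[] _ = xs≢[] refl
map≢[] {xs = _ ∷ _} _     ()

allPairs-mapWith : ∀ {A : Set} {P : A → Set} {R S : A → A → Set} {xs} →
                   (∀ {x y} → P x → P y → R x y → S x y) → All P xs → AllPairs R xs → AllPairs S xs
allPairs-mapWith f []         []         = []
allPairs-mapWith f (px ∷ pxs) (rx ∷ rxs) = All.zipWith (λ (py , r) → f px py r) (pxs , rx) ∷ allPairs-mapWith f pxs rxs

module _ {A : Set} {_≈_ : A → A → Set} (≈-sym : Symmetric _≈_) (≈-trans : Transitive _≈_) where

  private
    ─-keeps : ∀ {x z ys} (p : Any (x ≈_) ys) → Any (z ≈_) ys → ¬ z ≈ x → Any (z ≈_) (ys ─ p)
    ─-keeps (here x≈y) (here z≈y) z≉x = ⊥-elim (z≉x (≈-trans z≈y (≈-sym x≈y)))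
    ─-keeps (here _)   (there q)  _   = q
    ─-keeps (there _)  (here z≈y) _   = here z≈y
    ─-keeps (there p)  (there q)  z≉x = there (─-keeps p q z≉x)

  distinct-covered⇒length≤ : ∀ {xs ys} → AllPairs (λ x y → ¬ x ≈ y) xs →
                             All (λ x → Any (x ≈_) ys) xs → length xs ≤ length ys
  distinct-covered⇒length≤ {[]} _ _ = z≤n
  distinct-covered⇒length≤ {x ∷ xs} {ys} (x≉xs ∷ xs-distinct) (x∈ys ∷ xs∈ys) = begin
    suc (length xs)          ≤⟨ s≤s (distinct-covered⇒length≤ xs-distinct xs∈ys─x) ⟩
    suc (length (ys ─ x∈ys)) ≡⟨ sym (length-removeAt′ ys (index x∈ys)) ⟩
    length ys                ∎
    where
    open ≤-Reasoning
    xs∈ys─x : All (λ z → Any (z ≈_) (ys ─ x∈ys)) xs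
    xs∈ys─x = All.zipWith (λ (z∈ys , x≉z) → ─-keeps x∈ys z∈ys (x≉z ∘ ≈-sym)) (xs∈ys , x≉xs)

≋-refl : ∀ {S} → S ≋ S
≋-refl = (λ p → p) , (λ p → p)

≋-sym : ∀ {S T} → S ≋ T → T ≋ S
≋-sym (S⊆T , T⊆S) = T⊆S , S⊆T

≋-trans : ∀ {S T R} → S ≋ T → T ≋ R → S ≋ R
≋-trans (S⊆T , T⊆S) (T⊆R , R⊆T) = T⊆R ∘ S⊆T , T⊆S ∘ R⊆T

_≋?_ : ∀ S T → Dec (S ≋ T)
S ≋? T = S ⊆? T ×-dec T ⊆? S

∷-cong-≋ : ∀ {z S T} → S ≋ T → (z ∷ S) ≋ (z ∷ T)
∷-cong-≋ {z} (S⊆T , T⊆S) = ∷⁺ʳ z S⊆T , ∷⁺ʳ z T⊆S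

∷-cancel-≋ : ∀ {z c d} → z ∉ c → z ∉ d → (z ∷ c) ≋ (z ∷ d) → c ≋ d
∷-cancel-≋ {z} {c} {d} z∉c z∉d (z∷c⊆ , z∷d⊆) = drop z∉c z∷c⊆ , drop z∉d z∷d⊆
  where
  drop : ∀ {s t} → z ∉ s → z ∷ s ⊆ z ∷ t → s ⊆ t
  drop z∉s z∷s⊆ e∈s with z∷s⊆ (there e∈s)
  ... | here refl = ⊥-elim (z∉s e∈s)
  ... | there e∈t = e∈t

delete : ℕ → FSet → FSet
delete z = filter (λ e → ¬? (e ≟ z))

∈-delete⁻ : ∀ {z e X} → e ∈ delete z X → e ∈ X × e ≢ z
∈-delete⁻ {z} = ∈-filter⁻ (λ e → ¬? (e ≟ z))

∈-delete⁺ : ∀ {z e X} → e ∈ X → e ≢ z → e ∈ delete z X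
∈-delete⁺ {z} = ∈-filter⁺ (λ e → ¬? (e ≟ z))

delete-∉ : ∀ {z X} → z ∉ X → delete z X ≡ X
delete-∉ {z} z∉X = filter-all (λ e → ¬? (e ≟ z)) (All.tabulate λ e∈X e≡z → z∉X (subst (_∈ _) e≡z e∈X))

≋-∷-delete : ∀ {z X} → z ∈ X → X ≋ (z ∷ delete z X)
≋-∷-delete {z} {X} z∈X = X⊆ , ⊆X
  where
  X⊆ : X ⊆ z ∷ delete z X
  X⊆ {e} e∈X with e ≟ z
  ... | yes e≡z = here e≡z
  ... | no  e≢z = there (∈-delete⁺ e∈X e≢z)
  ⊆X : z ∷ delete z X ⊆ X
  ⊆X (here refl) = z∈X
  ⊆X (there e∈)  = proj₁ (∈-delete⁻ e∈)

card-mono : ∀ {A B} → A ⊆ B → card A ≤ card B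
card-mono {A} A⊆B = distinct-covered⇒length≤ sym trans (deduplicate-! A)
  (All.tabulate (∈-deduplicate⁺ _≟_ ∘ A⊆B ∘ ∈-deduplicate⁻ _≟_ A))

card-cong : ∀ {A B} → A ≋ B → card A ≡ card B
card-cong (A⊆B , B⊆A) = ≤-antisym (card-mono A⊆B) (card-mono B⊆A)

card-≡0 : ∀ {A} → (∀ {e} → e ∉ A) → card A ≡ 0
card-≡0 A-empty = n≤0⇒n≡0 (card-mono {B = []} (⊥-elim ∘ A-empty))

card-∷ : ∀ {z X} → z ∉ X → card (z ∷ X) ≡ suc (card X)
card-∷ {z} {X} z∉X = cong (suc ∘ length) (filter-all (λ e → ¬? (z ≟ e))
  (All.tabulate λ e∈ z≡e → z∉X (subst (_∈ X) (sym z≡e) (∈-deduplicate⁻ _≟_ X e∈))))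

card-delete-∈ : ∀ {z X} → z ∈ X → card X ≡ suc (card (delete z X))
card-delete-∈ {z} {X} z∈X =
  trans (card-cong (≋-∷-delete z∈X)) (card-∷ λ z∈ → proj₂ (∈-delete⁻ {z} {z} {X} z∈) refl)

card-delete-∉ : ∀ {z X} → z ∉ X → card (delete z X) ≡ card X
card-delete-∉ z∉X = cong card (delete-∉ z∉X)

card-< : ∀ {A B z} → A ⊆ B → z ∈ B → z ∉ A → card A < card B
card-< {A} {B} {z} A⊆B z∈B z∉A = begin-strict
  card A                  <⟨ s≤s (card-mono A⊆B∖z) ⟩
  suc (card (delete z B)) ≡⟨ card-delete-∈ z∈B ⟨
  card B                  ∎
  where
  open ≤-Reasoning
  A⊆B∖z : A ⊆ delete z B
  A⊆B∖z e∈A = ∈-delete⁺ (A⊆B e∈A) λ {refl → z∉A e∈A}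

card<⇒∃∉ : ∀ {A B} → A ⊆ B → card A < card B → ∃ λ z → z ∈ B × z ∉ A
card<⇒∃∉ {A} {B} A⊆B A<B with All.all? (_∈? A) B
... | yes B⊆A = ⊥-elim (<⇒≱ A<B (card-mono (All.lookup B⊆A)))
... | no  B⊈A = find (¬All⇒Any¬ (_∈? A) B B⊈A)

0<card⇒∃∈ : ∀ {A} → 0 < card A → ∃ (_∈ A)
0<card⇒∃∈ 0<A = let z , z∈A , _ = card<⇒∃∉ {[]} (λ ()) 0<A in z , z∈A

∈⇒0<card : ∀ {z A} → z ∈ A → 0 < card A
∈⇒0<card z∈A = card-< {[]} (λ ()) z∈A (λ ())

∈⋃⁺ : ∀ {e T Γ} → T ∈ Γ → e ∈ T → e ∈ ⋃ Γ
∈⋃⁺ T∈Γ e∈T = ∈-concat⁺′ e∈T T∈Γ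

∈⋃⁻ : ∀ {e} Γ → e ∈ ⋃ Γ → ∃ λ T → T ∈ Γ × e ∈ T
∈⋃⁻ Γ = find ∘ ∈-concat⁻ Γ

∈⋂⁻ : ∀ {e} Γ → e ∈ ⋂ Γ → All (e ∈_) Γ
∈⋂⁻ (S ∷ Γ) e∈ = let e∈S , e∈Γ = ∈-filter⁻ (λ x → All.all? (x ∈?_) Γ) e∈ in e∈S ∷ e∈Γ

∈⋂⁺ : ∀ {e Γ} → All (e ∈_) Γ → Γ ≢ [] → e ∈ ⋂ Γ
∈⋂⁺ {Γ = []}    _             Γ≢[] = ⊥-elim (Γ≢[] refl)
∈⋂⁺ {Γ = S ∷ Γ} (e∈S ∷ e∈Γ) _    = ∈-filter⁺ (λ x → All.all? (x ∈?_) Γ) e∈S e∈Γ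

⋂⊆⋃ : ∀ Γ → ⋂ Γ ⊆ ⋃ Γ
⋂⊆⋃ (S ∷ Γ) e∈ = ∈⋃⁺ {Γ = S ∷ Γ} (here refl) (All.head (∈⋂⁻ (S ∷ Γ) e∈))

⋃-mono : ∀ {Γ F} → Γ ⊑ F → ⋃ Γ ⊆ ⋃ F
⋃-mono {Γ} Γ⊑F e∈ = let T , T∈Γ , e∈T = ∈⋃⁻ Γ e∈ in ∈⋃⁺ (⊑-lookup Γ⊑F T∈Γ) e∈T

HKECondition : Coll → ℕ → Set
HKECondition F α = ∀ Γ → SubColl Γ F → card (⋃ Γ) + card (⋂ Γ) ≡ 2 * α

card-member : ∀ {S F α} → S ∈ F → HKECondition F α → card S ≡ α
card-member {S} {F} {α} S∈F hke = *-cancelˡ-≡ (card S) α 2 (begin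
  card S + (card S + 0)               ≡⟨ cong (card S +_) (+-identityʳ (card S)) ⟩
  card S + card S                     ≡⟨ cong₂ _+_ (cong card (++-identityʳ S)) (card-cong ⋂[S]≋S) ⟨
  card (⋃ (S ∷ [])) + card (⋂ (S ∷ [])) ≡⟨ hke (S ∷ []) (from∈ S∈F , λ ()) ⟩
  2 * α                               ∎)
  where
  open ≡-Reasoning
  ⋂[S]≋S : ⋂ (S ∷ []) ≋ S
  ⋂[S]≋S = All.head ∘ ∈⋂⁻ (S ∷ []) , λ e∈S → ∈⋂⁺ (e∈S ∷ []) (λ ())

⊑-map⁻ : ∀ (f : FSet → FSet) F {Γ′} → Γ′ ⊑ map f F → ∃ λ Γ → Γ ⊑ F × Γ′ ≡ map f Γ
⊑-map⁻ f []      []          = [] , [] , refl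
⊑-map⁻ f (T ∷ F) (_ ∷ʳ Γ′⊑) = let Γ , Γ⊑F , eq = ⊑-map⁻ f F Γ′⊑ in Γ , T ∷ʳ Γ⊑F , eq
⊑-map⁻ f (T ∷ F) (refl ∷ Γ′⊑) = let Γ , Γ⊑F , eq = ⊑-map⁻ f F Γ′⊑ in T ∷ Γ , refl ∷ Γ⊑F , cong (f T ∷_) eq

-- Removing a splitting pair

Splits : ℕ → ℕ → FSet → Set
Splits x y S = (x ∈ S × y ∉ S) ⊎ (y ∈ S × x ∉ S)

splits-sym : ∀ {x y S} → Splits x y S → Splits y x S
splits-sym (inj₁ p) = inj₂ p
splits-sym (inj₂ p) = inj₁ p

strip : ℕ → ℕ → FSet → FSet
strip x y = delete y ∘ delete x

∈-strip⁻ : ∀ {x y e} S → e ∈ strip x y S → e ∈ S × e ≢ x × e ≢ y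
∈-strip⁻ _ e∈ = let e∈S∖x , e≢y = ∈-delete⁻ e∈ ; e∈S , e≢x = ∈-delete⁻ e∈S∖x in e∈S , e≢x , e≢y

∈-strip⁺ : ∀ {x y e S} → e ∈ S → e ≢ x → e ≢ y → e ∈ strip x y S
∈-strip⁺ e∈S e≢x e≢y = ∈-delete⁺ (∈-delete⁺ e∈S e≢x) e≢y

strip≋⇒≋x∷ : ∀ {x y S c} → x ∈ S → y ∉ S → strip x y S ≋ c → S ≋ (x ∷ c)
strip≋⇒≋x∷ x∈S y∉S strip≋c =
  ≋-trans (≋-∷-delete x∈S) (∷-cong-≋ (subst (_≋ _) (delete-∉ (y∉S ∘ proj₁ ∘ ∈-delete⁻)) strip≋c))

strip≋⇒≋y∷ : ∀ {x y S c} → y ∈ S → x ∉ S → strip x y S ≋ c → S ≋ (y ∷ c)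
strip≋⇒≋y∷ {y = y} y∈S x∉S strip≋c =
  ≋-trans (≋-∷-delete y∈S) (∷-cong-≋ (subst (_≋ _) (cong (delete y) (delete-∉ x∉S)) strip≋c))

⋃-strip : ∀ x y Γ → ⋃ (map (strip x y) Γ) ≋ strip x y (⋃ Γ)
⋃-strip x y Γ = forth , back
  where
  forth : ⋃ (map (strip x y) Γ) ⊆ strip x y (⋃ Γ)
  forth e∈ with ∈⋃⁻ (map (strip x y) Γ) e∈
  ... | _ , T′∈ , e∈T′ with ∈-map⁻ (strip x y) T′∈
  ... | T , T∈Γ , refl = let e∈T , e≢x , e≢y = ∈-strip⁻ T e∈T′ in ∈-strip⁺ (∈⋃⁺ T∈Γ e∈T) e≢x e≢y
  back : strip x y (⋃ Γ) ⊆ ⋃ (map (strip x y) Γ)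
  back e∈ with ∈-strip⁻ (⋃ Γ) e∈
  ... | e∈⋃ , e≢x , e≢y = let T , T∈Γ , e∈T = ∈⋃⁻ Γ e∈⋃ in ∈⋃⁺ (∈-map⁺ (strip x y) T∈Γ) (∈-strip⁺ e∈T e≢x e≢y)

⋂-strip : ∀ x y {Γ} → Γ ≢ [] → ⋂ (map (strip x y) Γ) ≋ strip x y (⋂ Γ)
⋂-strip x y {[]}    Γ≢[] = ⊥-elim (Γ≢[] refl)
⋂-strip x y {S ∷ Γ} _    = forth , back
  where
  forth : ⋂ (map (strip x y) (S ∷ Γ)) ⊆ strip x y (⋂ (S ∷ Γ))
  forth e∈ with AllP.map⁻ {xs = S ∷ Γ} {f = strip x y} (∈⋂⁻ (map (strip x y) (S ∷ Γ)) e∈)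
  ... | e∈stripped@(e∈S′ ∷ _) = let _ , e≢x , e≢y = ∈-strip⁻ S e∈S′ in
    ∈-strip⁺ (∈⋂⁺ (All.map (λ {T} → proj₁ ∘ ∈-strip⁻ T) e∈stripped) (λ ())) e≢x e≢y
  back : strip x y (⋂ (S ∷ Γ)) ⊆ ⋂ (map (strip x y) (S ∷ Γ))
  back e∈ with ∈-strip⁻ (⋂ (S ∷ Γ)) e∈
  ... | e∈⋂ , e≢x , e≢y = ∈⋂⁺ (AllP.map⁺ (All.map (λ e∈T → ∈-strip⁺ e∈T e≢x e≢y) (∈⋂⁻ (S ∷ Γ) e∈⋂))) (λ ())

card-strip-∈∉ : ∀ {x y X} → x ∈ X → y ∉ X → card X ≡ suc (card (strip x y X))
card-strip-∈∉ {x} {y} {X} x∈X y∉X = begin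
  card X                      ≡⟨ card-delete-∈ x∈X ⟩
  suc (card (delete x X))     ≡⟨ cong suc (card-delete-∉ (y∉X ∘ proj₁ ∘ ∈-delete⁻)) ⟨
  suc (card (strip x y X))    ∎
  where open ≡-Reasoning

card-strip-∉∈ : ∀ {x y X} → x ∉ X → y ∈ X → card X ≡ suc (card (strip x y X))
card-strip-∉∈ {x} {y} {X} x∉X y∈X = begin
  card X                      ≡⟨ card-delete-∉ x∉X ⟨
  card (delete x X)           ≡⟨ card-delete-∈ (∈-delete⁺ y∈X λ {refl → x∉X y∈X}) ⟩
  suc (card (strip x y X))    ∎
  where open ≡-Reasoning

card-strip-∈∈ : ∀ {x y X} → x ≢ y → x ∈ X → y ∈ X → card X ≡ 2 + card (strip x y X)
card-strip-∈∈ {x} {y} {X} x≢y x∈X y∈X = begin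
  card X                      ≡⟨ card-delete-∈ x∈X ⟩
  suc (card (delete x X))     ≡⟨ cong suc (card-delete-∈ (∈-delete⁺ y∈X (x≢y ∘ sym))) ⟩
  2 + card (strip x y X)      ∎
  where open ≡-Reasoning

card-strip-∉∉ : ∀ {x y X} → x ∉ X → y ∉ X → card X ≡ card (strip x y X)
card-strip-∉∉ {x} {y} {X} x∉X y∉X = begin
  card X                      ≡⟨ card-delete-∉ x∉X ⟨
  card (delete x X)           ≡⟨ card-delete-∉ (y∉X ∘ proj₁ ∘ ∈-delete⁻) ⟨
  card (strip x y X)          ∎
  where open ≡-Reasoning

module _ {x y : ℕ} {Γ : Coll} (splits : All (Splits x y) Γ) where

  ∈⋂⇒∉⋃ : x ∈ ⋂ Γ → y ∉ ⋃ Γ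
  ∈⋂⇒∉⋃ x∈⋂ y∈⋃ with ∈⋃⁻ Γ y∈⋃
  ... | T , T∈Γ , y∈T with All.lookup splits T∈Γ
  ... | inj₁ (_ , y∉T) = y∉T y∈T
  ... | inj₂ (_ , x∉T) = x∉T (All.lookup (∈⋂⁻ Γ x∈⋂) T∈Γ)

  ∉⋂⇒∈⋃ : Γ ≢ [] → x ∉ ⋂ Γ → y ∈ ⋃ Γ
  ∉⋂⇒∈⋃ Γ≢[] x∉⋂ with find (¬All⇒Any¬ (x ∈?_) Γ (λ x∈Γ → x∉⋂ (∈⋂⁺ x∈Γ Γ≢[])))
  ... | T , T∈Γ , x∉T with All.lookup splits T∈Γ
  ... | inj₁ (x∈T , _) = ⊥-elim (x∉T x∈T)
  ... | inj₂ (y∈T , _) = ∈⋃⁺ T∈Γ y∈T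

card-⋃+⋂-strip : ∀ {x y Γ} → x ≢ y → Γ ≢ [] → All (Splits x y) Γ →
  card (⋃ Γ) + card (⋂ Γ) ≡ 2 + (card (⋃ (map (strip x y) Γ)) + card (⋂ (map (strip x y) Γ)))
card-⋃+⋂-strip {x} {y} {Γ} x≢y Γ≢[] splits = begin
  card (⋃ Γ) + card (⋂ Γ)
    ≡⟨ card-strip-⋃+⋂ (x ∈? ⋂ Γ) (y ∈? ⋂ Γ) ⟩
  2 + (card (strip x y (⋃ Γ)) + card (strip x y (⋂ Γ)))
    ≡⟨ cong (2 +_) (cong₂ _+_ (card-cong (⋃-strip x y Γ)) (card-cong (⋂-strip x y Γ≢[]))) ⟨
  2 + (card (⋃ (map (strip x y) Γ)) + card (⋂ (map (strip x y) Γ))) ∎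
  where
  open ≡-Reasoning
  card-strip-⋃+⋂ : Dec (x ∈ ⋂ Γ) → Dec (y ∈ ⋂ Γ) →
    card (⋃ Γ) + card (⋂ Γ) ≡ 2 + (card (strip x y (⋃ Γ)) + card (strip x y (⋂ Γ)))
  card-strip-⋃+⋂ (yes x∈⋂) _ = trans
    (cong₂ _+_ (card-strip-∈∉ (⋂⊆⋃ Γ x∈⋂) y∉⋃) (card-strip-∈∉ x∈⋂ (y∉⋃ ∘ ⋂⊆⋃ Γ)))
    (cong suc (+-suc _ _))
    where y∉⋃ = ∈⋂⇒∉⋃ splits x∈⋂
  card-strip-⋃+⋂ (no _) (yes y∈⋂) = trans
    (cong₂ _+_ (card-strip-∉∈ x∉⋃ (⋂⊆⋃ Γ y∈⋂)) (card-strip-∉∈ (x∉⋃ ∘ ⋂⊆⋃ Γ) y∈⋂))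
    (cong suc (+-suc _ _))
    where x∉⋃ = ∈⋂⇒∉⋃ (All.map splits-sym splits) y∈⋂
  card-strip-⋃+⋂ (no x∉⋂) (no y∉⋂) = cong₂ _+_
    (card-strip-∈∈ x≢y (∉⋂⇒∈⋃ (All.map splits-sym splits) Γ≢[] y∉⋂) (∉⋂⇒∈⋃ splits Γ≢[] x∉⋂))
    (card-strip-∉∉ x∉⋂ y∉⋂)

HKECondition-strip : ∀ {x y F α} → x ≢ y → All (Splits x y) F →
                     HKECondition F (suc α) → HKECondition (map (strip x y) F) α
HKECondition-strip {x} {y} {F} {α} x≢y splits hke Γ′ (Γ′⊑ , Γ′≢[]) with ⊑-map⁻ (strip x y) F Γ′⊑
... | Γ , Γ⊑F , refl = suc-injective (suc-injective (begin
  2 + (card (⋃ (map (strip x y) Γ)) + card (⋂ (map (strip x y) Γ)))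
    ≡⟨ card-⋃+⋂-strip x≢y Γ≢[] (All-resp-⊑ Γ⊑F splits) ⟨
  card (⋃ Γ) + card (⋂ Γ)  ≡⟨ hke Γ (Γ⊑F , Γ≢[]) ⟩
  2 * suc α                ≡⟨ *-suc 2 α ⟩
  2 + 2 * α                ∎))
  where
  open ≡-Reasoning
  Γ≢[] : Γ ≢ []
  Γ≢[] refl = Γ′≢[] refl

-- Existence of a splitting pair

degree : ℕ → Coll → ℕ
degree z F = length (filter (z ∈?_) F)

degree-≤ : ∀ {z y} F → (∀ {T} → T ∈ F → z ∈ T → y ∈ T) → degree z F ≤ degree y F
degree-≤ [] _ = z≤n
degree-≤ {z} {y} (T ∷ F) z⇒y with z ∈? T | y ∈? T
... | yes z∈T | no  y∉T = ⊥-elim (y∉T (z⇒y (here refl) z∈T))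
... | yes _   | yes _   = s≤s (degree-≤ F (z⇒y ∘ there))
... | no  _   | yes _   = m≤n⇒m≤1+n (degree-≤ F (z⇒y ∘ there))
... | no  _   | no  _   = degree-≤ F (z⇒y ∘ there)

degree-< : ∀ {z y S} F → (∀ {T} → T ∈ F → z ∈ T → y ∈ T) → S ∈ F → y ∈ S → z ∉ S → degree z F < degree y F
degree-< {z} {y} (T ∷ F) z⇒y (here refl) y∈T z∉T
  rewrite filter-reject (z ∈?_) {T} {F} z∉T | filter-accept (y ∈?_) {T} {F} y∈T
  = s≤s (degree-≤ F (z⇒y ∘ there))
degree-< {z} {y} (T ∷ F) z⇒y (there S∈F) y∈S z∉S with z ∈? T | y ∈? T
... | yes z∈T | no  y∉T = ⊥-elim (y∉T (z⇒y (here refl) z∈T))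
... | yes _   | yes _   = s≤s (degree-< F (z⇒y ∘ there) S∈F y∈S z∉S)
... | no  _   | yes _   = m≤n⇒m≤1+n (degree-< F (z⇒y ∘ there) S∈F y∈S z∉S)
... | no  _   | no  _   = degree-< F (z⇒y ∘ there) S∈F y∈S z∉S

module EmptyIntersection {F : Coll} {α : ℕ} (hke : HKECondition F (suc α)) (F≢[] : F ≢ [])
                         (⋂F-empty : ∀ {z} → z ∉ ⋂ F) where

  card-⋃F : card (⋃ F) ≡ 2 * suc α
  card-⋃F = begin
    card (⋃ F)              ≡⟨ +-identityʳ _ ⟨
    card (⋃ F) + 0          ≡⟨ cong (card (⋃ F) +_) (card-≡0 ⋂F-empty) ⟨
    card (⋃ F) + card (⋂ F) ≡⟨ hke F (⊆-refl , F≢[]) ⟩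
    2 * suc α               ∎
    where open ≡-Reasoning

  card-⋃+⋂≡card-⋃F : ∀ {Γ} → SubColl Γ F → card (⋃ Γ) + card (⋂ Γ) ≡ card (⋃ F)
  card-⋃+⋂≡card-⋃F {Γ} sub = trans (hke Γ sub) (sym card-⋃F)

  ⋂-inhabited : ∀ Γ {z} → SubColl Γ F → z ∈ ⋃ F → z ∉ ⋃ Γ → ∃ (_∈ ⋂ Γ)
  ⋂-inhabited Γ sub z∈⋃F z∉⋃Γ = 0<card⇒∃∈ (+-cancelˡ-< (card (⋃ Γ)) 0 _ (begin-strict
    card (⋃ Γ) + 0          ≡⟨ +-identityʳ _ ⟩
    card (⋃ Γ)              <⟨ card-< (⋃-mono (proj₁ sub)) z∈⋃F z∉⋃Γ ⟩
    card (⋃ F)              ≡⟨ card-⋃+⋂≡card-⋃F sub ⟨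
    card (⋃ Γ) + card (⋂ Γ) ∎))
    where open ≤-Reasoning

  ⋃-incomplete : ∀ Γ {w} → SubColl Γ F → w ∈ ⋂ Γ → ∃ λ z → z ∈ ⋃ F × z ∉ ⋃ Γ
  ⋃-incomplete Γ sub w∈⋂Γ = card<⇒∃∉ (⋃-mono (proj₁ sub))
    (subst (card (⋃ Γ) <_) (card-⋃+⋂≡card-⋃F sub) (m<m+n (card (⋃ Γ)) (∈⇒0<card w∈⋂Γ)))

  ⋃F-inhabited : ∃ (_∈ ⋃ F)
  ⋃F-inhabited = 0<card⇒∃∈ (subst (0 <_) (sym card-⋃F) (s≤s z≤n))

  y₀ : ℕ
  y₀ = argmin (λ z → degree z F) (proj₁ ⋃F-inhabited) (⋃ F)

  y₀∈⋃F : y₀ ∈ ⋃ F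
  y₀∈⋃F = argmin-all (λ z → degree z F) (proj₂ ⋃F-inhabited) (All.tabulate (λ z∈ → z∈))

  y₀-minimal : ∀ {z} → z ∈ ⋃ F → degree y₀ F ≤ degree z F
  y₀-minimal = All.lookup (f[argmin]≤f[xs] (proj₁ ⋃F-inhabited) (⋃ F))

  avoids-y₀? : (T : FSet) → Dec (y₀ ∉ T)
  avoids-y₀? T = ¬? (y₀ ∈? T)

  avoiders : Coll
  avoiders = filter avoids-y₀? F

  avoider : ∃ λ T → T ∈ F × y₀ ∉ T
  avoider = find (¬All⇒Any¬ (y₀ ∈?_) F (λ y₀∈F → ⋂F-empty (∈⋂⁺ y₀∈F F≢[])))

  avoiders≢[] : avoiders ≢ []
  avoiders≢[] = let _ , T∈F , y₀∉T = avoider in ∈⇒≢[] (∈-filter⁺ avoids-y₀? T∈F y₀∉T)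

  ⋂avoiders-inhabited : ∃ (_∈ ⋂ avoiders)
  ⋂avoiders-inhabited = ⋂-inhabited avoiders (filter-⊑ avoids-y₀? F , avoiders≢[]) y₀∈⋃F y₀∉⋃avoiders
    where
    y₀∉⋃avoiders : y₀ ∉ ⋃ avoiders
    y₀∉⋃avoiders y₀∈ = let _ , T∈ , y₀∈T = ∈⋃⁻ avoiders y₀∈ in proj₂ (∈-filter⁻ avoids-y₀? {xs = F} T∈) y₀∈T

  w : ℕ
  w = proj₁ ⋂avoiders-inhabited

  avoids-y₀⇒∋w : ∀ {T} → T ∈ F → y₀ ∉ T → w ∈ T
  avoids-y₀⇒∋w T∈F y₀∉T = All.lookup (∈⋂⁻ avoiders (proj₂ ⋂avoiders-inhabited)) (∈-filter⁺ avoids-y₀? T∈F y₀∉T)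

  w∈⋃F : w ∈ ⋃ F
  w∈⋃F = let _ , T∈F , y₀∉T = avoider in ∈⋃⁺ T∈F (avoids-y₀⇒∋w T∈F y₀∉T)

  y₀≢w : y₀ ≢ w
  y₀≢w y₀≡w = let T , T∈F , y₀∉T = avoider in y₀∉T (subst (_∈ T) (sym y₀≡w) (avoids-y₀⇒∋w T∈F y₀∉T))

  -- If S ∋ y₀, w then w is common to S and the avoiders, so their union misses some z ∈ ⋃ F;
  -- every member containing z contains y₀, but S does not contain z, so z has smaller degree.
  y₀∈⇒w∉ : ∀ {S} → S ∈ F → y₀ ∈ S → w ∉ S
  y₀∈⇒w∉ {S} S∈F y₀∈S w∈S = degree-below-y₀ (⋃-incomplete Γ (filter-⊑ Γ? F , ∈⇒≢[] S∈Γ) w∈⋂Γ)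
    where
    Γ? : (T : FSet) → Dec (y₀ ∉ T ⊎ T ≡ S)
    Γ? T = avoids-y₀? T ⊎-dec ≡-dec _≟_ T S
    Γ : Coll
    Γ = filter Γ? F
    S∈Γ : S ∈ Γ
    S∈Γ = ∈-filter⁺ Γ? S∈F (inj₂ refl)
    w∈⋂Γ : w ∈ ⋂ Γ
    w∈⋂Γ = ∈⋂⁺ {Γ = Γ} (All.tabulate (λ T∈Γ → w∈ (∈-filter⁻ Γ? {xs = F} T∈Γ))) (∈⇒≢[] S∈Γ)
      where
      w∈ : ∀ {T} → T ∈ F × (y₀ ∉ T ⊎ T ≡ S) → w ∈ T
      w∈ (T∈F , inj₁ y₀∉T) = avoids-y₀⇒∋w T∈F y₀∉T
      w∈ (_   , inj₂ refl) = w∈S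
    degree-below-y₀ : ¬ (∃ λ z → z ∈ ⋃ F × z ∉ ⋃ Γ)
    degree-below-y₀ (z , z∈⋃F , z∉⋃Γ) = <⇒≱ (degree-< {z} {y₀} F z⇒y₀ S∈F y₀∈S (z∉⋃Γ ∘ ∈⋃⁺ S∈Γ)) (y₀-minimal z∈⋃F)
      where
      z⇒y₀ : ∀ {T} → T ∈ F → z ∈ T → y₀ ∈ T
      z⇒y₀ {T} T∈F z∈T = decidable-stable (y₀ ∈? T)
        λ y₀∉T → z∉⋃Γ (∈⋃⁺ (∈-filter⁺ Γ? T∈F (inj₁ y₀∉T)) z∈T)

  splits : All (Splits y₀ w) F
  splits = All.tabulate λ {S} S∈F → split S∈F (y₀ ∈? S)
    where
    split : ∀ {S} → S ∈ F → Dec (y₀ ∈ S) → Splits y₀ w S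
    split S∈F (yes y₀∈S) = inj₁ (y₀∈S , y₀∈⇒w∉ S∈F y₀∈S)
    split S∈F (no  y₀∉S) = inj₂ (avoids-y₀⇒∋w S∈F y₀∉S , y₀∉S)

record SplittingPair (F : Coll) (A : List ℕ) : Set where
  field
    x y      : ℕ
    x≢y      : x ≢ y
    splits   : All (Splits x y) F
    x∈⋃F     : x ∈ ⋃ F
    y∈⋃F⊎∉A : y ∈ ⋃ F ⊎ y ∉ A

fresh : List ℕ → ℕ
fresh L = suc (max 0 L)

fresh-∉ : ∀ L → fresh L ∉ L
fresh-∉ L fresh∈L = 1+n≰n (All.lookup (xs≤max 0 L) fresh∈L)

commonElementPair : ∀ {F x} A → x ∈ ⋂ F → SplittingPair F A
commonElementPair {F} {x} A x∈⋂F = record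
  { x = x ; y = y ; x≢y = λ {refl → y∉⋃F x∈⋃F} ; splits = All.tabulate split
  ; x∈⋃F = x∈⋃F ; y∈⋃F⊎∉A = inj₂ (fresh-∉ (A ++ ⋃ F) ∘ ∈-++⁺ˡ) }
  where
  y : ℕ
  y = fresh (A ++ ⋃ F)
  y∉⋃F : y ∉ ⋃ F
  y∉⋃F = fresh-∉ (A ++ ⋃ F) ∘ ∈-++⁺ʳ A
  x∈⋃F : x ∈ ⋃ F
  x∈⋃F = ⋂⊆⋃ F x∈⋂F
  split : ∀ {S} → S ∈ F → Splits x y S
  split S∈F = inj₁ (All.lookup (∈⋂⁻ F x∈⋂F) S∈F , y∉⋃F ∘ ∈⋃⁺ S∈F)

emptyIntersectionPair : ∀ {F α} A → HKECondition F (suc α) → F ≢ [] → (∀ {z} → z ∉ ⋂ F) → SplittingPair F A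
emptyIntersectionPair A hke F≢[] ⋂F-empty = record
  { x = y₀ ; y = w ; x≢y = y₀≢w ; splits = splits ; x∈⋃F = y₀∈⋃F ; y∈⋃F⊎∉A = inj₁ w∈⋃F }
  where open EmptyIntersection hke F≢[] ⋂F-empty

empty⊎inhabited : (L : List ℕ) → (∀ {z} → z ∉ L) ⊎ ∃ (_∈ L)
empty⊎inhabited []      = inj₁ λ ()
empty⊎inhabited (x ∷ _) = inj₂ (x , here refl)

splittingPair : ∀ {F α} A → HKECondition F (suc α) → F ≢ [] → SplittingPair F A
splittingPair {F} A hke F≢[] with empty⊎inhabited (⋂ F)
... | inj₁ ⋂F-empty     = emptyIntersectionPair A hke F≢[] ⋂F-empty
... | inj₂ (_ , x∈⋂F) = commonElementPair A x∈⋂F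

-- Cubes

Pairs : Set
Pairs = List (ℕ × ℕ)

pairElems : Pairs → List ℕ
pairElems []            = []
pairElems ((a , b) ∷ P) = a ∷ b ∷ pairElems P

cube : Pairs → Coll
cube []            = [] ∷ []
cube ((a , b) ∷ P) = map (a ∷_) (cube P) ++ map (b ∷_) (cube P)

length-cube : ∀ P → length (cube P) ≡ 2 ^ length P
length-cube []            = refl
length-cube ((a , b) ∷ P) = begin
  length (map (a ∷_) (cube P) ++ map (b ∷_) (cube P))        ≡⟨ length-++ (map (a ∷_) (cube P)) ⟩
  length (map (a ∷_) (cube P)) + length (map (b ∷_) (cube P)) ≡⟨ cong₂ _+_ (length-map _ (cube P)) (length-map _ (cube P)) ⟩
  length (cube P) + length (cube P)                          ≡⟨ cong (λ n → n + n) (length-cube P) ⟩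
  2 ^ length P + 2 ^ length P                                ≡⟨ cong (2 ^ length P +_) (+-identityʳ _) ⟨
  2 ^ suc (length P)                                         ∎
  where open ≡-Reasoning

cube≢[] : ∀ P → cube P ≢ []
cube≢[] P cube≡[] = <⇒≢ (m^n>0 2 (length P)) (trans (cong length (sym cube≡[])) (length-cube P))

∈cube-∷⁻ : ∀ {a b P T} → T ∈ cube ((a , b) ∷ P) → ∃ λ c → c ∈ cube P × (T ≡ a ∷ c ⊎ T ≡ b ∷ c)
∈cube-∷⁻ {a} {b} {P} T∈ with ∈-++⁻ (map (a ∷_) (cube P)) T∈
... | inj₁ T∈a∷ = let c , c∈ , T≡ = ∈-map⁻ (a ∷_) T∈a∷ in c , c∈ , inj₁ T≡
... | inj₂ T∈b∷ = let c , c∈ , T≡ = ∈-map⁻ (b ∷_) T∈b∷ in c , c∈ , inj₂ T≡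

∈cube⇒⊆pairElems : ∀ {P c} → c ∈ cube P → c ⊆ pairElems P
∈cube⇒⊆pairElems {[]} (here refl) ()
∈cube⇒⊆pairElems {(a , b) ∷ P} c∈ e∈c with ∈cube-∷⁻ {P = P} c∈
... | d , d∈ , inj₁ refl = ∷⁺ʳ a (there ∘ ∈cube⇒⊆pairElems d∈) e∈c
... | d , d∈ , inj₂ refl = there (∷⁺ʳ b (∈cube⇒⊆pairElems d∈) e∈c)

strip-∷ : ∀ {a b h c} → a ≢ b → h ≡ a ⊎ h ≡ b → a ∉ c → b ∉ c → strip a b (h ∷ c) ≡ c
strip-∷ {a} {b} {_} {c} a≢b (inj₁ refl) a∉c b∉c = begin
  delete b (delete a (a ∷ c)) ≡⟨ cong (delete b) (filter-reject (λ e → ¬? (e ≟ a)) (λ a≢a → a≢a refl)) ⟩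
  delete b (delete a c)       ≡⟨ cong (delete b) (delete-∉ a∉c) ⟩
  delete b c                  ≡⟨ delete-∉ b∉c ⟩
  c                           ∎
  where open ≡-Reasoning
strip-∷ {a} {b} {_} {c} a≢b (inj₂ refl) a∉c b∉c = begin
  delete b (delete a (b ∷ c)) ≡⟨ cong (delete b) (filter-accept (λ e → ¬? (e ≟ a)) (a≢b ∘ sym)) ⟩
  delete b (b ∷ delete a c)   ≡⟨ filter-reject (λ e → ¬? (e ≟ b)) (λ b≢b → b≢b refl) ⟩
  delete b (delete a c)       ≡⟨ cong (delete b) (delete-∉ a∉c) ⟩
  delete b c                  ≡⟨ delete-∉ b∉c ⟩
  c                           ∎
  where open ≡-Reasoning

module _ {a b P} (unique : Unique (pairElems ((a , b) ∷ P))) where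

  private
    a≢b : a ≢ b
    a≢b = All.head (AllPairs.head unique)
    a∉c : ∀ {c} → c ∈ cube P → a ∉ c
    a∉c c∈ = All¬⇒¬Any (All.tail (AllPairs.head unique)) ∘ ∈cube⇒⊆pairElems c∈
    b∉c : ∀ {c} → c ∈ cube P → b ∉ c
    b∉c c∈ = All¬⇒¬Any (AllPairs.head (AllPairs.tail unique)) ∘ ∈cube⇒⊆pairElems c∈

  ∈cube⇒splits : ∀ {T} → T ∈ cube ((a , b) ∷ P) → Splits a b T
  ∈cube⇒splits T∈ with ∈cube-∷⁻ {P = P} T∈
  ... | c , c∈ , inj₁ refl = inj₁ (here refl , λ { (here b≡a) → a≢b (sym b≡a) ; (there b∈c) → b∉c c∈ b∈c })
  ... | c , c∈ , inj₂ refl = inj₂ (here refl , λ { (here a≡b) → a≢b a≡b ; (there a∈c) → a∉c c∈ a∈c })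

  ∈cube⇒strip∈cube : ∀ {T} → T ∈ cube ((a , b) ∷ P) → strip a b T ∈ cube P
  ∈cube⇒strip∈cube T∈ with ∈cube-∷⁻ {P = P} T∈
  ... | c , c∈ , inj₁ refl = subst (_∈ cube P) (sym (strip-∷ a≢b (inj₁ refl) (a∉c c∈) (b∉c c∈))) c∈
  ... | c , c∈ , inj₂ refl = subst (_∈ cube P) (sym (strip-∷ a≢b (inj₂ refl) (a∉c c∈) (b∉c c∈))) c∈

card-⋃+⋂-cube : ∀ P → Unique (pairElems P) → ∀ {Γ} → Γ ≢ [] → All (_∈ cube P) Γ →
                card (⋃ Γ) + card (⋂ Γ) ≡ 2 * length P
card-⋃+⋂-cube [] _ {Γ} _ Γ⊆cube = cong₂ _+_ (card-≡0 ⋃Γ-empty) (card-≡0 (⋃Γ-empty ∘ ⋂⊆⋃ Γ))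
  where
  ⋃Γ-empty : ∀ {e} → e ∉ ⋃ Γ
  ⋃Γ-empty e∈ with ∈⋃⁻ Γ e∈
  ... | T , T∈Γ , e∈T with All.lookup Γ⊆cube T∈Γ
  ... | here refl = ¬Any[] e∈T
card-⋃+⋂-cube ((a , b) ∷ P) unique {Γ} Γ≢[] Γ⊆cube = begin
  card (⋃ Γ) + card (⋂ Γ)
    ≡⟨ card-⋃+⋂-strip (All.head (AllPairs.head unique)) Γ≢[] (All.map (∈cube⇒splits unique) Γ⊆cube) ⟩
  2 + (card (⋃ (map (strip a b) Γ)) + card (⋂ (map (strip a b) Γ)))
    ≡⟨ cong (2 +_) (card-⋃+⋂-cube P (AllPairs.tail (AllPairs.tail unique)) (map≢[] Γ≢[])
                     (AllP.map⁺ (All.map (∈cube⇒strip∈cube unique) Γ⊆cube))) ⟩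
  2 + 2 * length P
    ≡⟨ *-suc 2 (length P) ⟨
  2 * suc (length P) ∎
  where open ≡-Reasoning

HKECondition-cube : ∀ P → Unique (pairElems P) → HKECondition (cube P) (length P)
HKECondition-cube P unique Γ (Γ⊑cube , Γ≢[]) = card-⋃+⋂-cube P unique Γ≢[] (All.tabulate (⊑-lookup Γ⊑cube))

cube-distinct : ∀ P → Unique (pairElems P) → Distinct (cube P)
cube-distinct []            _      = [] ∷ []
cube-distinct ((a , b) ∷ P) ((a≢b ∷ a∉P) ∷ b∉P ∷ uniqueP) =
  APP.++⁺ (APP.map⁺ (prefix-distinct (All¬⇒¬Any a∉P))) (APP.map⁺ (prefix-distinct (All¬⇒¬Any b∉P)))
          (AllP.map⁺ (All.tabulate λ c∈ → AllP.map⁺ (All.tabulate λ d∈ → a∷c≉b∷d c∈ d∈)))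
  where
  prefix-distinct : ∀ {z} → z ∉ pairElems P → AllPairs (λ c d → ¬ (z ∷ c) ≋ (z ∷ d)) (cube P)
  prefix-distinct z∉P = allPairs-mapWith (λ z∉c z∉d c≉d → c≉d ∘ ∷-cancel-≋ z∉c z∉d)
    (All.tabulate λ c∈ → z∉P ∘ ∈cube⇒⊆pairElems c∈) (cube-distinct P uniqueP)
  a∷c≉b∷d : ∀ {c d} → c ∈ cube P → d ∈ cube P → ¬ (a ∷ c) ≋ (b ∷ d)
  a∷c≉b∷d c∈ d∈ (a∷c⊆ , _) with a∷c⊆ (here refl)
  ... | here a≡b  = a≢b a≡b
  ... | there a∈d = All¬⇒¬Any a∉P (∈cube⇒⊆pairElems d∈ a∈d)

-- Every hke collection lies in a cube

-- A records the elements already used by outer pairs, which fresh elements must avoid.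
record CubeCover (F : Coll) (α : ℕ) (A : List ℕ) : Set where
  field
    pairs        : Pairs
    length-pairs : length pairs ≡ α
    unique       : Unique (pairElems pairs)
    covers       : F ⊆C cube pairs
    ∈⋃F⊎∉A      : ∀ {z} → z ∈ pairElems pairs → z ∈ ⋃ F ⊎ z ∉ A

  length-cube-pairs : length (cube pairs) ≡ 2 ^ α
  length-cube-pairs = trans (length-cube pairs) (cong (2 ^_) length-pairs)

cubeCover : ∀ α {F} A → HKECondition F α → F ≢ [] → CubeCover F α A
cubeCover zero {F} A hke F≢[] = record
  { pairs = [] ; length-pairs = refl ; unique = [] ; covers = All.tabulate S≋[] ; ∈⋃F⊎∉A = λ () }
  where
  S≋[] : ∀ {S} → S ∈ F → Any (S ≋_) (cube [])
  S≋[] S∈F = here ((λ e∈S → ⊥-elim (<⇒≢ (∈⇒0<card e∈S) (sym (card-member S∈F hke)))) , λ ())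
cubeCover (suc α) {F} A hke F≢[] = record
  { pairs = (x , y) ∷ IH.pairs ; length-pairs = cong suc IH.length-pairs
  ; unique = (x≢y ∷ ¬Any⇒All¬ _ x∉P′) ∷ ¬Any⇒All¬ _ y∉P′ ∷ IH.unique
  ; covers = All.tabulate cover ; ∈⋃F⊎∉A = ∈P⇒∈⋃F⊎∉A }
  where
  open SplittingPair (splittingPair A hke F≢[])
  module IH = CubeCover (cubeCover α (x ∷ y ∷ A) (HKECondition-strip x≢y splits hke) (map≢[] F≢[]))

  ∈P′⇒ : ∀ {z} → z ∈ pairElems IH.pairs → (z ∈ ⋃ F ⊎ z ∉ A) × z ≢ x × z ≢ y
  ∈P′⇒ z∈P′ with IH.∈⋃F⊎∉A z∈P′
  ... | inj₁ z∈⋃F′ = let z∈⋃F , z≢x , z≢y = ∈-strip⁻ (⋃ F) (proj₁ (⋃-strip x y F) z∈⋃F′) in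
    inj₁ z∈⋃F , z≢x , z≢y
  ... | inj₂ z∉xyA = inj₂ (z∉xyA ∘ there ∘ there) , z∉xyA ∘ here , z∉xyA ∘ there ∘ here

  x∉P′ : x ∉ pairElems IH.pairs
  x∉P′ x∈P′ = proj₁ (proj₂ (∈P′⇒ x∈P′)) refl
  y∉P′ : y ∉ pairElems IH.pairs
  y∉P′ y∈P′ = proj₂ (proj₂ (∈P′⇒ y∈P′)) refl

  ∈P⇒∈⋃F⊎∉A : ∀ {z} → z ∈ pairElems ((x , y) ∷ IH.pairs) → z ∈ ⋃ F ⊎ z ∉ A
  ∈P⇒∈⋃F⊎∉A (here refl)         = inj₁ x∈⋃F
  ∈P⇒∈⋃F⊎∉A (there (here refl)) = y∈⋃F⊎∉A
  ∈P⇒∈⋃F⊎∉A (there (there z∈P′)) = proj₁ (∈P′⇒ z∈P′)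

  cover : ∀ {S} → S ∈ F → Any (S ≋_) (cube ((x , y) ∷ IH.pairs))
  cover {S} S∈F with find (All.lookup (AllP.map⁻ IH.covers) S∈F) | All.lookup splits S∈F
  ... | c , c∈ , strip≋c | inj₁ (x∈S , y∉S) =
    lose (∈-++⁺ˡ (∈-map⁺ (x ∷_) c∈)) (strip≋⇒≋x∷ x∈S y∉S strip≋c)
  ... | c , c∈ , strip≋c | inj₂ (y∈S , x∉S) =
    lose (∈-++⁺ʳ (map (x ∷_) (cube IH.pairs)) (∈-map⁺ (y ∷_) c∈)) (strip≋⇒≋y∷ y∈S x∉S strip≋c)

⊆C⇒length≤ : ∀ {F G} → Distinct F → F ⊆C G → length F ≤ length G
⊆C⇒length≤ = distinct-covered⇒length≤ ≋-sym ≋-trans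

length≤2^α : ∀ {F} α → Distinct F → HKECondition F α → F ≢ [] → length F ≤ 2 ^ α
length≤2^α {F} α F-distinct hke F≢[] = begin
  length F            ≤⟨ ⊆C⇒length≤ F-distinct covers ⟩
  length (cube pairs) ≡⟨ length-cube-pairs ⟩
  2 ^ α               ∎
  where
  open CubeCover (cubeCover α [] hke F≢[])
  open ≤-Reasoning

⊂C⇒length< : ∀ {F G} → Distinct F → F ⊂C G → length F < length G
⊂C⇒length< {F} {G} F-distinct (F⊆G , G⊈F) with find (¬All⇒Any¬ (λ T → Any.any? (T ≋?_) F) G G⊈F)
... | U , U∈G , U∉F = ⊆C⇒length≤ (¬Any⇒All¬ F U∉F ∷ F-distinct) (lose U∈G ≋-refl ∷ F⊆G)

⊆C⇒≡α : ∀ {F G} α β → F ≢ [] → F ⊆C G → HKECondition F α → HKECondition G β → α ≡ β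
⊆C⇒≡α {[]}    _ _ F≢[] _           _    _    = ⊥-elim (F≢[] refl)
⊆C⇒≡α {S ∷ F} _ _ _    (S∈G ∷ _) hkeF hkeG = let T , T∈G , S≋T = find S∈G in
  trans (sym (card-member (here refl) hkeF)) (trans (card-cong S≋T) (card-member T∈G hkeG))

mainTheorem1 : (F : Coll) (α : ℕ) → Distinct F → IsHKE F α →
                 (Maximal F ⇔ length F ≡ 2 ^ α)
mainTheorem1 F α F-distinct (F≢[] , 1≤α , hke) = mk⇔ maximal⇒length≡2^α length≡2^α⇒maximal
  where
  open CubeCover (cubeCover α [] hke F≢[])

  cube-HKE : HKE (cube pairs)
  cube-HKE = α , cube≢[] pairs , 1≤α , subst (HKECondition (cube pairs)) length-pairs (HKECondition-cube pairs unique)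

  maximal⇒length≡2^α : Maximal F → length F ≡ 2 ^ α
  maximal⇒length≡2^α (_ , no-extension) = ≤-antisym (length≤2^α α F-distinct hke F≢[]) (≮⇒≥ λ F<2^α →
    no-extension (cube pairs , cube-distinct pairs unique , cube-HKE , covers , λ cube⊆F →
      <⇒≱ F<2^α (subst (_≤ length F) length-cube-pairs (⊆C⇒length≤ (cube-distinct pairs unique) cube⊆F))))

  length≡2^α⇒maximal : length F ≡ 2 ^ α → Maximal F
  length≡2^α⇒maximal F≡2^α = (α , F≢[] , 1≤α , hke) , λ (G , G-distinct , (β , G≢[] , _ , hkeG) , F⊂G) →
    <⇒≱ (⊂C⇒length< F-distinct F⊂G) (begin
      length G ≤⟨ length≤2^α β G-distinct hkeG G≢[] ⟩
      2 ^ β    ≡⟨ cong (2 ^_) (⊆C⇒≡α α β F≢[] (proj₁ F⊂G) hke hkeG) ⟨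
      2 ^ α    ≡⟨ F≡2^α ⟨
      length F ∎)
    where open ≤-Reasoning
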